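{- Let $E$ be a closed pure context, $t$ a closed term, and $x\notin\mathrm{fv}(E)$. Then $(\lambda x.E[x])\,t \approx E[t]$.
   Context: The calculus $\lambda_S$: terms $t ::= v \mid t\,t \mid \mathcal{S}k.t \mid \langle t\rangle$, values $v ::= x \mid \lambda x.t$. Pure contexts $E ::= \square \mid v\,E \mid E\,t$. Labeled transition system on closed terms with labels $\tau$, closed values $v$, closed pure contexts $E$: $(\lambda x.t)\,v \xrightarrow{\tau} t\{v/x\}$; if $t_0\xrightarrow{\tau}t_0'$ then $t_0\,t_1\xrightarrow{\tau}t_0'\,t_1$; if $t\xrightarrow{\tau}t'$ then $v\,t\xrightarrow{\tau}v\,t'$; $\langle v\rangle\xrightarrow{\tau}v$; if $t\xrightarrow{\tau}t'$ then $\langle t\rangle\xrightarrow{\tau}\langle t'\rangle$; if $t\xrightarrow{\square}t'$ then $\langle t\rangle\xrightarrow{\tau}t'$; $\lambda x.t\xrightarrow{v}t\{v/x\}$; $\mathcal{S}k.t\xrightarrow{E}\langle t\{\lambda x.\langle E[x]\rangle/k\}\rangle$ ($x\notin\mathrm{fv}(E)$); if $t_0\xrightarrow{E[\square\,t_1]}t_0'$ then $t_0\,t_1\xrightarrow{E}t_0'$; if $t\xrightarrow{E[v\,\square]}t'$ then $v\,t\xrightarrow{E}t'$. $\overset{\tau}{\Rightarrow}$ is the reflexive-transitive closure of $\xrightarrow{\tau}$; for $\alpha\ne\tau$, $\overset{\alpha}{\Rightarrow}=\overset{\tau}{\Rightarrow}\xrightarrow{\alpha}$. $R$ on closed terms is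 an applicative simulation if $t_0\,R\,t_1$ and $t_0\xrightarrow{\alpha}t_0'$ imply $t_1\overset{\alpha}{\Rightarrow}t_1'$ with $t_0'\,R\,t_1'$ for some $t_1'$; an applicative bisimulation if $R$ and $R^{ -1}$ are simulations; applicative bisimilarity $\approx$ is the largest applicative bisimulation. -}

module Defs where

open import Data.Nat using (ℕ; zero; suc)
open import Data.Fin using (Fin; zero; suc)
open import Data.Product using (Σ; _×_; _,_)
open import Relation.Binary.Construct.Closure.ReflexiveTransitive using (Star)

-- Terms of λ_S in de Bruijn representation, indexed by the number of
-- free variables in scope.  Both λ and S bind one variable (index 0).
data Tm (n : ℕ) : Set where
  var   : Fin n → Tm n
  lam   : Tm (suc n) → Tm n
  app   : Tm n → Tm n → Tm n
  shift : Tm (suc n) → Tm n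
  reset : Tm n → Tm n

data Value {n : ℕ} : Tm n → Set where
  var : (i : Fin n) → Value (var i)
  lam : (t : Tm (suc n)) → Value (lam t)

ext : ∀ {m n} → (Fin m → Fin n) → Fin (suc m) → Fin (suc n)
ext ρ zero    = zero
ext ρ (suc i) = suc (ρ i)

rename : ∀ {m n} → (Fin m → Fin n) → Tm m → Tm n
rename ρ (var i)   = var (ρ i)
rename ρ (lam t)   = lam (rename (ext ρ) t)
rename ρ (app t u) = app (rename ρ t) (rename ρ u)
rename ρ (shift t) = shift (rename (ext ρ) t)
rename ρ (reset t) = reset (rename ρ t)

exts : ∀ {m n} → (Fin m → Tm n) → Fin (suc m) → Tm (suc n)
exts σ zero    = var zero
exts σ (suc i) = rename suc (σ i)

subst : ∀ {m n} → (Fin m → Tm n) → Tm m → Tm n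
subst σ (var i)   = σ i
subst σ (lam t)   = lam (subst (exts σ) t)
subst σ (app t u) = app (subst σ t) (subst σ u)
subst σ (shift t) = shift (subst (exts σ) t)
subst σ (reset t) = reset (subst σ t)

_[_] : ∀ {n} → Tm (suc n) → Tm n → Tm n
t [ v ] = subst σ t
  where
  σ : _ → _
  σ zero    = v
  σ (suc i) = var i

wk : ∀ {n} → Tm 0 → Tm n
wk = rename (λ ())

data Ctx : Set where
  hole : Ctx
  appR : (v : Tm 0) → Value v → Ctx → Ctx
  appL : Ctx → Tm 0 → Ctx

-- plugging (a closed context may be filled with an open term)
plug : ∀ {n} → Ctx → Tm n → Tm n
plug hole         t = t
plug (appR v _ E) t = app (wk v) (plug E t)
plug (appL E u)   t = app (plug E t) (wk u)

_∘c_ : Ctx → Ctx → Ctx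
hole         ∘c F = F
appR v vv E  ∘c F = appR v vv (E ∘c F)
appL E u     ∘c F = appL (E ∘c F) u

data Label : Set where
  τ   : Label
  val : (v : Tm 0) → Value v → Label
  ctx : Ctx → Label

data _─[_]→_ : Tm 0 → Label → Tm 0 → Set where
  β       : ∀ {t v} → Value v → app (lam t) v ─[ τ ]→ (t [ v ])
  appL-τ  : ∀ {t₀ t₀' t₁} → t₀ ─[ τ ]→ t₀' → app t₀ t₁ ─[ τ ]→ app t₀' t₁
  appR-τ  : ∀ {v t t'} → Value v → t ─[ τ ]→ t' → app v t ─[ τ ]→ app v t'
  reset-v : ∀ {v} → Value v → reset v ─[ τ ]→ v
  reset-τ : ∀ {t t'} → t ─[ τ ]→ t' → reset t ─[ τ ]→ reset t'
  reset-□ : ∀ {t t'} → t ─[ ctx hole ]→ t' → reset t ─[ τ ]→ t'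
  lam-v   : ∀ {t v} (vv : Value v) → lam t ─[ val v vv ]→ (t [ v ])
  shift-E : ∀ {t} (E : Ctx) →
            shift t ─[ ctx E ]→ reset (t [ lam (reset (plug E (var zero))) ])
  appL-E  : ∀ {t₀ t₀' t₁ E} → t₀ ─[ ctx (E ∘c appL hole t₁) ]→ t₀' →
            app t₀ t₁ ─[ ctx E ]→ t₀'
  appR-E  : ∀ {v t t' E} (vv : Value v) → t ─[ ctx (E ∘c appR v vv hole) ]→ t' →
            app v t ─[ ctx E ]→ t'

_─τ→*_ : Tm 0 → Tm 0 → Set
_─τ→*_ = Star (λ a b → a ─[ τ ]→ b)

_═[_]⇒_ : Tm 0 → Label → Tm 0 → Set
t ═[ τ ]⇒ t' = t ─τ→* t'
t ═[ α ]⇒ t' = Σ (Tm 0) λ s → (t ─τ→* s) × (s ─[ α ]→ t')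

Rel₀ : Set₁
Rel₀ = Tm 0 → Tm 0 → Set

IsSimulation : Rel₀ → Set
IsSimulation R = ∀ {t₀ t₁ t₀' α} → R t₀ t₁ → t₀ ─[ α ]→ t₀' →
                 Σ (Tm 0) λ t₁' → (t₁ ═[ α ]⇒ t₁') × R t₀' t₁'

IsBisimulation : Rel₀ → Set
IsBisimulation R = IsSimulation R × IsSimulation (λ a b → R b a)

-- applicative bisimilarity: the largest applicative bisimulation,
-- i.e. the union of all applicative bisimulations
_≈_ : Tm 0 → Tm 0 → Set₁
t₀ ≈ t₁ = Σ Rel₀ λ R → IsBisimulation R × R t₀ t₁

module Submission where

open import Defs
open import Data.Fin using (Fin; zero; suc)
open import Data.Nat using (ℕ; suc)
open import Data.Product using (Σ; _×_; _,_)
open import Function using (_∘_)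
open import Relation.Binary.PropositionalEquality
  using (_≡_; refl; sym; trans; cong; cong₂; subst₂)
  renaming (subst to ≡-subst)
open import Relation.Binary.Construct.Closure.ReflexiveTransitive
  using (ε; _◅_; _◅◅_; gmap)

-- The compatible closure ∼ of the pairs (λx.E[x]) s ∼ E[s'] with s ∼ s'
-- is a bisimulation once labels are also compared up to ∼ (a captured
-- context may contain related subterms).  Each transition of the left term
-- is matched: a step inside s is a step inside s', the β-step to E[s] is
-- matched by no step at all, and everything else is structural.
-- Conversely a transition of E[s'] either comes from s', and is mirrored
-- under the argument position, or s' is a value; then s evaluates to a
-- value s₀ ∼ s' and the left term reaches E[s₀], which differs from E[s']
-- only below λ and S binders (the relation _∼ₛ_), so it matches every
-- transition of E[s'] by a single transition.

ext-cong : ∀ {m n} {ρ ρ' : Fin m → Fin n} →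
  (∀ i → ρ i ≡ ρ' i) → ∀ i → ext ρ i ≡ ext ρ' i
ext-cong eq zero    = refl
ext-cong eq (suc i) = cong suc (eq i)

ext-∘ : ∀ {l m n} (ρ : Fin m → Fin n) (ρ' : Fin l → Fin m) →
  ∀ i → ext ρ (ext ρ' i) ≡ ext (ρ ∘ ρ') i
ext-∘ ρ ρ' zero    = refl
ext-∘ ρ ρ' (suc i) = refl

rename-cong : ∀ {m n} {ρ ρ' : Fin m → Fin n} →
  (∀ i → ρ i ≡ ρ' i) → ∀ t → rename ρ t ≡ rename ρ' t
rename-cong eq (var i)   = cong var (eq i)
rename-cong eq (lam t)   = cong lam (rename-cong (ext-cong eq) t)
rename-cong eq (app t u) = cong₂ app (rename-cong eq t) (rename-cong eq u)
rename-cong eq (shift t) = cong shift (rename-cong (ext-cong eq) t)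
rename-cong eq (reset t) = cong reset (rename-cong eq t)

rename-∘ : ∀ {l m n} (ρ : Fin m → Fin n) (ρ' : Fin l → Fin m) t →
  rename ρ (rename ρ' t) ≡ rename (ρ ∘ ρ') t
rename-∘ ρ ρ' (var i)   = refl
rename-∘ ρ ρ' (lam t)   =
  cong lam (trans (rename-∘ (ext ρ) (ext ρ') t) (rename-cong (ext-∘ ρ ρ') t))
rename-∘ ρ ρ' (app t u) = cong₂ app (rename-∘ ρ ρ' t) (rename-∘ ρ ρ' u)
rename-∘ ρ ρ' (shift t) =
  cong shift (trans (rename-∘ (ext ρ) (ext ρ') t) (rename-cong (ext-∘ ρ ρ') t))
rename-∘ ρ ρ' (reset t) = cong reset (rename-∘ ρ ρ' t)

ext-id : ∀ {n} {ρ : Fin n → Fin n} → (∀ i → ρ i ≡ i) → ∀ i → ext ρ i ≡ i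
ext-id eq zero    = refl
ext-id eq (suc i) = cong suc (eq i)

rename-id : ∀ {n} {ρ : Fin n → Fin n} → (∀ i → ρ i ≡ i) → ∀ t → rename ρ t ≡ t
rename-id eq (var i)   = cong var (eq i)
rename-id eq (lam t)   = cong lam (rename-id (ext-id eq) t)
rename-id eq (app t u) = cong₂ app (rename-id eq t) (rename-id eq u)
rename-id eq (shift t) = cong shift (rename-id (ext-id eq) t)
rename-id eq (reset t) = cong reset (rename-id eq t)

exts-cong : ∀ {m n} {σ σ' : Fin m → Tm n} →
  (∀ i → σ i ≡ σ' i) → ∀ i → exts σ i ≡ exts σ' i
exts-cong eq zero    = refl
exts-cong eq (suc i) = cong (rename suc) (eq i)

exts-ext : ∀ {l m n} (σ : Fin m → Tm n) (ρ : Fin l → Fin m) →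
  ∀ i → exts σ (ext ρ i) ≡ exts (σ ∘ ρ) i
exts-ext σ ρ zero    = refl
exts-ext σ ρ (suc i) = refl

subst-cong : ∀ {m n} {σ σ' : Fin m → Tm n} →
  (∀ i → σ i ≡ σ' i) → ∀ t → subst σ t ≡ subst σ' t
subst-cong eq (var i)   = eq i
subst-cong eq (lam t)   = cong lam (subst-cong (exts-cong eq) t)
subst-cong eq (app t u) = cong₂ app (subst-cong eq t) (subst-cong eq u)
subst-cong eq (shift t) = cong shift (subst-cong (exts-cong eq) t)
subst-cong eq (reset t) = cong reset (subst-cong eq t)

subst-rename : ∀ {l m n} (σ : Fin m → Tm n) (ρ : Fin l → Fin m) t →
  subst σ (rename ρ t) ≡ subst (σ ∘ ρ) t
subst-rename σ ρ (var i)   = refl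
subst-rename σ ρ (lam t)   =
  cong lam (trans (subst-rename (exts σ) (ext ρ) t) (subst-cong (exts-ext σ ρ) t))
subst-rename σ ρ (app t u) = cong₂ app (subst-rename σ ρ t) (subst-rename σ ρ u)
subst-rename σ ρ (shift t) =
  cong shift (trans (subst-rename (exts σ) (ext ρ) t) (subst-cong (exts-ext σ ρ) t))
subst-rename σ ρ (reset t) = cong reset (subst-rename σ ρ t)

exts-var : ∀ {m n} {σ : Fin m → Tm n} {ρ : Fin m → Fin n} →
  (∀ i → σ i ≡ var (ρ i)) → ∀ i → exts σ i ≡ var (ext ρ i)
exts-var eq zero    = refl
exts-var eq (suc i) = cong (rename suc) (eq i)

subst-var≡rename : ∀ {m n} {σ : Fin m → Tm n} {ρ : Fin m → Fin n} →
  (∀ i → σ i ≡ var (ρ i)) → ∀ t → subst σ t ≡ rename ρ t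
subst-var≡rename eq (var i)   = eq i
subst-var≡rename eq (lam t)   = cong lam (subst-var≡rename (exts-var eq) t)
subst-var≡rename eq (app t u) = cong₂ app (subst-var≡rename eq t) (subst-var≡rename eq u)
subst-var≡rename eq (shift t) = cong shift (subst-var≡rename (exts-var eq) t)
subst-var≡rename eq (reset t) = cong reset (subst-var≡rename eq t)

rename-wk : ∀ {m n} (ρ : Fin m → Fin n) (v : Tm 0) → rename ρ (wk v) ≡ wk v
rename-wk ρ v = trans (rename-∘ ρ _ v) (rename-cong (λ ()) v)

subst-wk : ∀ {m n} (σ : Fin m → Tm n) (v : Tm 0) → subst σ (wk v) ≡ wk v
subst-wk σ v = trans (subst-rename σ _ v) (subst-var≡rename (λ ()) v)

wk-closed : (u : Tm 0) → wk u ≡ u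
wk-closed = rename-id (λ ())

plug-rename : ∀ {m n} (ρ : Fin m → Fin n) E t →
  rename ρ (plug E t) ≡ plug E (rename ρ t)
plug-rename ρ hole         t = refl
plug-rename ρ (appR v _ E) t = cong₂ app (rename-wk ρ v) (plug-rename ρ E t)
plug-rename ρ (appL E u)   t = cong₂ app (plug-rename ρ E t) (rename-wk ρ u)

plug-subst : ∀ {m n} (σ : Fin m → Tm n) E t →
  subst σ (plug E t) ≡ plug E (subst σ t)
plug-subst σ hole         t = refl
plug-subst σ (appR v _ E) t = cong₂ app (subst-wk σ v) (plug-subst σ E t)
plug-subst σ (appL E u)   t = cong₂ app (plug-subst σ E t) (subst-wk σ u)

plug-[] : ∀ E (v : Tm 0) → plug E (var zero) [ v ] ≡ plug E v
plug-[] E v = plug-subst _ E (var zero)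

plug-∘c : ∀ {n} E F (t : Tm n) → plug (E ∘c F) t ≡ plug E (plug F t)
plug-∘c hole         F t = refl
plug-∘c (appR v _ E) F t = cong (app (wk v)) (plug-∘c E F t)
plug-∘c (appL E u)   F t = cong (λ z → app z (wk u)) (plug-∘c E F t)

∘c-identityʳ : ∀ E → E ∘c hole ≡ E
∘c-identityʳ hole          = refl
∘c-identityʳ (appR v vv E) = cong (appR v vv) (∘c-identityʳ E)
∘c-identityʳ (appL E u)    = cong (λ z → appL z u) (∘c-identityʳ E)

∘c-assoc : ∀ E F G → (E ∘c F) ∘c G ≡ E ∘c (F ∘c G)
∘c-assoc hole          F G = refl
∘c-assoc (appR v vv E) F G = cong (appR v vv) (∘c-assoc E F G)
∘c-assoc (appL E u)    F G = cong (λ z → appL z u) (∘c-assoc E F G)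

Value-rename : ∀ {m n} (ρ : Fin m → Fin n) {v} → Value v → Value (rename ρ v)
Value-rename ρ (var i) = var (ρ i)
Value-rename ρ (lam t) = lam _

Value-irrelevant : ∀ {n} {v : Tm n} (p q : Value v) → p ≡ q
Value-irrelevant (var i) (var .i) = refl
Value-irrelevant (lam t) (lam .t) = refl

appR-cong : ∀ {w v} (e : w ≡ v) (vw : Value w) (vv : Value v) E →
  appR w vw E ≡ appR v vv E
appR-cong refl vw vv E = cong (λ p → appR _ p E) (Value-irrelevant vw vv)

appL-wk : ∀ E u F → (E ∘c appL hole (wk u)) ∘c F ≡ E ∘c appL F u
appL-wk E u F =
  trans (∘c-assoc E (appL hole (wk u)) F) (cong (λ z → E ∘c appL F z) (wk-closed u))

appR-wk : ∀ E v vv vw F → (E ∘c appR (wk v) vw hole) ∘c F ≡ E ∘c appR v vv F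
appR-wk E v vv vw F =
  trans (∘c-assoc E (appR (wk v) vw hole) F) (cong (E ∘c_) (appR-cong (wk-closed v) vw vv F))

infix 4 _∼_ _∼c_ _∼L_

data _∼c_ : Ctx → Ctx → Set

data _∼_ {n : ℕ} : Tm n → Tm n → Set where
  var   : ∀ i → var i ∼ var i
  lam   : ∀ {a b} → a ∼ b → lam a ∼ lam b
  app   : ∀ {a b a' b'} → a ∼ a' → b ∼ b' → app a b ∼ app a' b'
  shift : ∀ {a b} → a ∼ b → shift a ∼ shift b
  reset : ∀ {a b} → a ∼ b → reset a ∼ reset b
  base  : ∀ E {s s'} → s ∼ s' → app (lam (plug E (var zero))) s ∼ plug E s'

-- The base clause for contexts lets a context captured from the left term,
-- whose innermost frame is the argument position of λx.E[x], be related to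
-- the corresponding context E ∘c F' captured from the right term.
data _∼c_ where
  hole : hole ∼c hole
  appR : ∀ {v v' vv vv' F F'} → v ∼ v' → F ∼c F' → appR v vv F ∼c appR v' vv' F'
  appL : ∀ {F F' u u'} → F ∼c F' → u ∼ u' → appL F u ∼c appL F' u'
  base : ∀ E vv {F F'} → F ∼c F' → appR (lam (plug E (var zero))) vv F ∼c E ∘c F'

data _∼L_ : Label → Label → Set where
  τ   : τ ∼L τ
  val : ∀ {v v' vv vv'} → v ∼ v' → val v vv ∼L val v' vv'
  ctx : ∀ {F F'} → F ∼c F' → ctx F ∼L ctx F'

∼-refl : ∀ {n} (t : Tm n) → t ∼ t
∼-refl (var i)   = var i
∼-refl (lam t)   = lam (∼-refl t)
∼-refl (app t u) = app (∼-refl t) (∼-refl u)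
∼-refl (shift t) = shift (∼-refl t)
∼-refl (reset t) = reset (∼-refl t)

∼c-refl : ∀ F → F ∼c F
∼c-refl hole          = hole
∼c-refl (appR v vv F) = appR (∼-refl v) (∼c-refl F)
∼c-refl (appL F u)    = appL (∼c-refl F) (∼-refl u)

∼L-refl : ∀ α → α ∼L α
∼L-refl τ          = τ
∼L-refl (val v vv) = val (∼-refl v)
∼L-refl (ctx F)    = ctx (∼c-refl F)

∼-rename : ∀ {m n} (ρ : Fin m → Fin n) {a b} → a ∼ b → rename ρ a ∼ rename ρ b
∼-rename ρ (var i)     = var (ρ i)
∼-rename ρ (lam r)     = lam (∼-rename (ext ρ) r)
∼-rename ρ (app r r')  = app (∼-rename ρ r) (∼-rename ρ r')
∼-rename ρ (shift r)   = shift (∼-rename (ext ρ) r)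
∼-rename ρ (reset r)   = reset (∼-rename ρ r)
∼-rename ρ (base E {s} {s'} r) =
  subst₂ _∼_ (cong (λ z → app (lam z) (rename ρ s)) (sym (plug-rename (ext ρ) E (var zero))))
             (sym (plug-rename ρ E s'))
             (base E (∼-rename ρ r))

∼-exts : ∀ {m n} {σ σ' : Fin m → Tm n} →
  (∀ i → σ i ∼ σ' i) → ∀ i → exts σ i ∼ exts σ' i
∼-exts r zero    = var zero
∼-exts r (suc i) = ∼-rename suc (r i)

∼-subst : ∀ {m n} {σ σ' : Fin m → Tm n} →
  (∀ i → σ i ∼ σ' i) → ∀ {a b} → a ∼ b → subst σ a ∼ subst σ' b
∼-subst rσ (var i)    = rσ i
∼-subst rσ (lam r)    = lam (∼-subst (∼-exts rσ) r)
∼-subst rσ (app r r') = app (∼-subst rσ r) (∼-subst rσ r')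
∼-subst rσ (shift r)  = shift (∼-subst (∼-exts rσ) r)
∼-subst rσ (reset r)  = reset (∼-subst rσ r)
∼-subst {σ = σ} {σ'} rσ (base E {s} {s'} r) =
  subst₂ _∼_ (cong (λ z → app (lam z) (subst σ s)) (sym (plug-subst (exts σ) E (var zero))))
             (sym (plug-subst σ' E s'))
             (base E (∼-subst rσ r))

∼-[] : ∀ {n} {a b : Tm (suc n)} {v v'} → a ∼ b → v ∼ v' → a [ v ] ∼ b [ v' ]
∼-[] r rv = ∼-subst (λ { zero → rv ; (suc i) → var i }) r

∼c-∘c : ∀ {F F' G G'} → F ∼c F' → G ∼c G' → F ∘c G ∼c F' ∘c G'
∼c-∘c hole        rG = rG
∼c-∘c (appR r rF) rG = appR r (∼c-∘c rF rG)
∼c-∘c (appL rF r) rG = appL (∼c-∘c rF rG) r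
∼c-∘c {G' = G'} (base E vv {F' = F'} rF) rG =
  ≡-subst (_ ∼c_) (sym (∘c-assoc E F' G')) (base E vv (∼c-∘c rF rG))

∼-plug : ∀ {n} {F F'} {a b : Tm n} → F ∼c F' → a ∼ b → plug F a ∼ plug F' b
∼-plug hole        r = r
∼-plug (appR q rF) r = app (∼-rename _ q) (∼-plug rF r)
∼-plug (appL rF q) r = app (∼-plug rF r) (∼-rename _ q)
∼-plug {a = a} {b} (base E vv {F' = F'} rF) r =
  subst₂ _∼_ (cong (λ z → app (lam z) (plug _ a)) (sym (plug-rename _ E (var zero))))
             (sym (plug-∘c E F' b))
             (base E (∼-plug rF r))

∼c-base-hole : ∀ E vv → appR (lam (plug E (var zero))) vv hole ∼c E
∼c-base-hole E vv = ≡-subst (appR (lam (plug E (var zero))) vv hole ∼c_) (∘c-identityʳ E) (base E vv hole)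

∼-Value : ∀ {a b : Tm 0} → a ∼ b → Value a → Value b
∼-Value (lam r) (lam _) = lam _

cast-ctx : ∀ {s b F G} → F ≡ G → s ─[ ctx F ]→ b → s ─[ ctx G ]→ b
cast-ctx refl d = d

plug-τ : ∀ E {s s'} → s ─[ τ ]→ s' → plug E s ─[ τ ]→ plug E s'
plug-τ hole          d = d
plug-τ (appR v vv E) d = appR-τ (Value-rename _ vv) (plug-τ E d)
plug-τ (appL E u)    d = appL-τ (plug-τ E d)

plug-τ* : ∀ E {s s'} → s ─τ→* s' → plug E s ─τ→* plug E s'
plug-τ* E = gmap (plug E) (plug-τ E)

plug-ctx : ∀ E {F s b} → s ─[ ctx (F ∘c E) ]→ b → plug E s ─[ ctx F ]→ b
plug-ctx hole          {F} d = cast-ctx (∘c-identityʳ F) d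
plug-ctx (appL E u)    {F} d = appL-E (plug-ctx E (cast-ctx (sym (appL-wk F u E)) d))
plug-ctx (appR v vv E) {F} d =
  appR-E vw (plug-ctx E (cast-ctx (sym (appR-wk F v vv vw E)) d))
  where vw = Value-rename _ vv

Value-plug⁻¹ : ∀ F {s : Tm 0} → Value (plug F s) → Value s
Value-plug⁻¹ hole         v = v
Value-plug⁻¹ (appR _ _ F) ()
Value-plug⁻¹ (appL F _)   ()

data PlugStep (E : Ctx) (s : Tm 0) : Label → Tm 0 → Set where
  inner-τ   : ∀ {s'} → s ─[ τ ]→ s' → PlugStep E s τ (plug E s')
  inner-ctx : ∀ {F b} → s ─[ ctx (F ∘c E) ]→ b → PlugStep E s (ctx F) b
  value     : ∀ {α b} → Value s → PlugStep E s α b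

plug-step⁻¹ : ∀ E {s α b} → plug E s ─[ α ]→ b → PlugStep E s α b
appL-step⁻¹ : ∀ F u {s α b X} → plug F s ≡ X → app X (wk u) ─[ α ]→ b →
  PlugStep (appL F u) s α b
appR-step⁻¹ : ∀ v vv F {s α b X W} → plug F s ≡ X → wk v ≡ W → app W X ─[ α ]→ b →
  PlugStep (appR v vv F) s α b

plug-step⁻¹ hole {α = τ}        d          = inner-τ d
plug-step⁻¹ hole {α = val v vv} (lam-v _)  = value (lam _)
plug-step⁻¹ hole {α = ctx F}    d          = inner-ctx (cast-ctx (sym (∘c-identityʳ F)) d)
plug-step⁻¹ (appL F u)    d = appL-step⁻¹ F u refl d
plug-step⁻¹ (appR v vv F) d = appR-step⁻¹ v vv F refl refl d

appL-step⁻¹ F u e    (β vv)       = value (Value-plug⁻¹ F (≡-subst Value (sym e) (lam _)))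
appL-step⁻¹ F u refl (appR-τ vv d) = value (Value-plug⁻¹ F vv)
appL-step⁻¹ F u refl (appR-E vv d) = value (Value-plug⁻¹ F vv)
appL-step⁻¹ F u refl (appL-τ d) with plug-step⁻¹ F d
... | inner-τ ds = inner-τ ds
... | value vs   = value vs
appL-step⁻¹ F u refl (appL-E {E = G} d) with plug-step⁻¹ F d
... | inner-ctx ds = inner-ctx (cast-ctx (appL-wk G u F) ds)
... | value vs     = value vs

appR-step⁻¹ v vv F e w (β vv')        = value (Value-plug⁻¹ F (≡-subst Value (sym e) vv'))
appR-step⁻¹ .(lam t) (lam t) F e refl (appL-τ ())
appR-step⁻¹ .(lam t) (lam t) F e refl (appL-E ())
appR-step⁻¹ v vv F refl refl (appR-τ vv' d) with plug-step⁻¹ F d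
... | inner-τ ds = inner-τ ds
... | value vs   = value vs
appR-step⁻¹ v vv F refl refl (appR-E {E = G} vv' d) with plug-step⁻¹ F d
... | inner-ctx ds = inner-ctx (cast-ctx (appR-wk G v vv vv' F) ds)
... | value vs     = value vs

weak-step : ∀ {α a s b} → a ─τ→* s → s ─[ α ]→ b → a ═[ α ]⇒ b
weak-step {τ}        p d = p ◅◅ (d ◅ ε)
weak-step {val v vv} p d = _ , p , d
weak-step {ctx F}    p d = _ , p , d

τ*-◅◅-weak : ∀ {α a c b} → a ─τ→* c → c ═[ α ]⇒ b → a ═[ α ]⇒ b
τ*-◅◅-weak {τ}        p q            = p ◅◅ q
τ*-◅◅-weak {val v vv} p (s , q , d) = s , p ◅◅ q , d
τ*-◅◅-weak {ctx F}    p (s , q , d) = s , p ◅◅ q , d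

∼-reaches-Value : ∀ {a b : Tm 0} → a ∼ b → Value b →
  Σ (Tm 0) λ a₀ → a ─τ→* a₀ × Value a₀ × a₀ ∼ b
∼-reaches-Value (lam r) (lam _) = _ , ε , lam _ , lam r
∼-reaches-Value (base hole r) vb with ∼-reaches-Value r vb
... | a₀ , p , va , q = a₀ , gmap _ (appR-τ (lam _)) p ◅◅ (β va ◅ ε) , va , q
∼-reaches-Value (base (appR _ _ _) r) ()
∼-reaches-Value (base (appL _ _) r) ()

-- Closed terms related by _∼_ only below binders.  Their transitions match
-- one-for-one, because every base pair sits under a λ or an S and is thus
-- only ever substituted into, never reduced.
infix 4 _∼ₛ_
data _∼ₛ_ : Tm 0 → Tm 0 → Set where
  lam   : ∀ {a b} → a ∼ b → lam a ∼ₛ lam b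
  app   : ∀ {a b a' b'} → a ∼ₛ a' → b ∼ₛ b' → app a b ∼ₛ app a' b'
  shift : ∀ {a b} → a ∼ b → shift a ∼ₛ shift b
  reset : ∀ {a b} → a ∼ₛ b → reset a ∼ₛ reset b

∼ₛ-refl : ∀ t → t ∼ₛ t
∼ₛ-refl (var ())
∼ₛ-refl (lam t)   = lam (∼-refl t)
∼ₛ-refl (app t u) = app (∼ₛ-refl t) (∼ₛ-refl u)
∼ₛ-refl (shift t) = shift (∼-refl t)
∼ₛ-refl (reset t) = reset (∼ₛ-refl t)

∼ₛ-plug : ∀ E {a b} → a ∼ₛ b → plug E a ∼ₛ plug E b
∼ₛ-plug hole         r = r
∼ₛ-plug (appR v _ E) r = app (∼ₛ-refl _) (∼ₛ-plug E r)
∼ₛ-plug (appL E u)   r = app (∼ₛ-plug E r) (∼ₛ-refl _)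

∼ₛ⇒∼ : ∀ {a b} → a ∼ₛ b → a ∼ b
∼ₛ⇒∼ (lam r)    = lam r
∼ₛ⇒∼ (app r r') = app (∼ₛ⇒∼ r) (∼ₛ⇒∼ r')
∼ₛ⇒∼ (shift r)  = shift r
∼ₛ⇒∼ (reset r)  = reset (∼ₛ⇒∼ r)

∼⇒∼ₛ-Value : ∀ {a b} → Value a → Value b → a ∼ b → a ∼ₛ b
∼⇒∼ₛ-Value (lam _) (lam _) (lam r) = lam r

∼ₛ-Value⁻¹ : ∀ {a b} → a ∼ₛ b → Value b → Value a
∼ₛ-Value⁻¹ (lam r) _ = lam _

∼ₛ-step⁻¹ : ∀ {a b b' α α'} → a ∼ₛ b → b ─[ α' ]→ b' → α ∼L α' →
  Σ (Tm 0) λ a' → a ─[ α ]→ a' × a' ∼ b'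
∼ₛ-step⁻¹ (app (lam r) r₂) (β vv) τ = _ , β (∼ₛ-Value⁻¹ r₂ vv) , ∼-[] r (∼ₛ⇒∼ r₂)
∼ₛ-step⁻¹ (app r₁ r₂) (appL-τ d) τ with ∼ₛ-step⁻¹ r₁ d τ
... | _ , d' , q = _ , appL-τ d' , app q (∼ₛ⇒∼ r₂)
∼ₛ-step⁻¹ (app r₁ r₂) (appR-τ vv d) τ with ∼ₛ-step⁻¹ r₂ d τ
... | _ , d' , q = _ , appR-τ (∼ₛ-Value⁻¹ r₁ vv) d' , app (∼ₛ⇒∼ r₁) q
∼ₛ-step⁻¹ (reset r) (reset-v vv) τ = _ , reset-v (∼ₛ-Value⁻¹ r vv) , ∼ₛ⇒∼ r
∼ₛ-step⁻¹ (reset r) (reset-τ d) τ with ∼ₛ-step⁻¹ r d τ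
... | _ , d' , q = _ , reset-τ d' , reset q
∼ₛ-step⁻¹ (reset r) (reset-□ d) τ with ∼ₛ-step⁻¹ r d (ctx hole)
... | _ , d' , q = _ , reset-□ d' , q
∼ₛ-step⁻¹ (lam r) (lam-v vv) (val {vv = vv₁} q) = _ , lam-v vv₁ , ∼-[] r q
∼ₛ-step⁻¹ (shift r) (shift-E F') (ctx {F = F} c) =
  _ , shift-E F , reset (∼-[] r (lam (reset (∼-plug c (var zero)))))
∼ₛ-step⁻¹ (app r₁ r₂) (appL-E d) (ctx c)
  with ∼ₛ-step⁻¹ r₁ d (ctx (∼c-∘c c (appL hole (∼ₛ⇒∼ r₂))))
... | _ , d' , q = _ , appL-E d' , q
∼ₛ-step⁻¹ (app r₁ r₂) (appR-E vv d) (ctx c)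
  with ∼ₛ-step⁻¹ r₂ d (ctx (∼c-∘c c (appR {vv = ∼ₛ-Value⁻¹ r₁ vv} (∼ₛ⇒∼ r₁) hole)))
... | _ , d' , q = _ , appR-E (∼ₛ-Value⁻¹ r₁ vv) d' , q

∼-simulation : ∀ {a b a' α α'} → a ∼ b → a ─[ α ]→ a' → α ∼L α' →
  Σ (Tm 0) λ b' → b ═[ α' ]⇒ b' × a' ∼ b'
∼-simulation (app (lam r) r₂) (β vv) τ = _ , (β (∼-Value r₂ vv) ◅ ε) , ∼-[] r r₂
∼-simulation (base E {s} r) (β vv) τ =
  _ , ε , subst₂ _∼_ (sym (plug-[] E s)) refl (∼-plug (∼c-refl E) r)
∼-simulation (app r₁ r₂) (appL-τ d) τ with ∼-simulation r₁ d τ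
... | _ , p , q = _ , gmap _ appL-τ p , app q r₂
∼-simulation (base E r) (appL-τ ()) τ
∼-simulation (app r₁ r₂) (appR-τ vv d) τ with ∼-simulation r₂ d τ
... | _ , p , q = _ , gmap _ (appR-τ (∼-Value r₁ vv)) p , app r₁ q
∼-simulation (base E r) (appR-τ vv d) τ with ∼-simulation r d τ
... | _ , p , q = _ , plug-τ* E p , base E q
∼-simulation (reset r) (reset-v vv) τ = _ , (reset-v (∼-Value r vv) ◅ ε) , r
∼-simulation (reset r) (reset-τ d) τ with ∼-simulation r d τ
... | _ , p , q = _ , gmap _ reset-τ p , reset q
∼-simulation (reset r) (reset-□ d) τ with ∼-simulation r d (ctx hole)
... | _ , (_ , p , d') , q = _ , gmap _ reset-τ p ◅◅ (reset-□ d' ◅ ε) , q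
∼-simulation (lam r) (lam-v vv) (val {vv' = vv'} q) = _ , (_ , ε , lam-v vv') , ∼-[] r q
∼-simulation (shift r) (shift-E F) (ctx {F' = F'} c) =
  _ , (_ , ε , shift-E F') , reset (∼-[] r (lam (reset (∼-plug c (var zero)))))
∼-simulation (app r₁ r₂) (appL-E d) (ctx c) with ∼-simulation r₁ d (ctx (∼c-∘c c (appL hole r₂)))
... | _ , (_ , p , d') , q = _ , (_ , gmap _ appL-τ p , appL-E d') , q
∼-simulation (base E r) (appL-E ()) (ctx c)
∼-simulation (app r₁ r₂) (appR-E vv d) (ctx c)
  with ∼-simulation r₂ d (ctx (∼c-∘c c (appR {vv' = ∼-Value r₁ vv} r₁ hole)))
... | _ , (_ , p , d') , q =
  _ , (_ , gmap _ (appR-τ (∼-Value r₁ vv)) p , appR-E (∼-Value r₁ vv) d') , q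
∼-simulation (base E r) (appR-E vv d) (ctx c)
  with ∼-simulation r d (ctx (∼c-∘c c (∼c-base-hole E vv)))
... | _ , (_ , p , d') , q = _ , (_ , plug-τ* E p , plug-ctx E d') , q

base-Value-simulation⁻¹ : ∀ E {s s' b' α α'} → s ∼ s' → Value s' →
  plug E s' ─[ α' ]→ b' → α ∼L α' →
  Σ (Tm 0) λ a' → app (lam (plug E (var zero))) s ═[ α ]⇒ a' × a' ∼ b'
base-Value-simulation⁻¹ E r vs d rα with ∼-reaches-Value r vs
... | s₀ , p , vs₀ , q with ∼ₛ-step⁻¹ (∼ₛ-plug E (∼⇒∼ₛ-Value vs₀ vs q)) d rα
... | a' , d' , q' =
  a' , τ*-◅◅-weak (gmap _ (appR-τ (lam _)) p)
                  (weak-step (β vs₀ ◅ ε) (≡-subst (_─[ _ ]→ a') (sym (plug-[] E s₀)) d')) , q'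

∼-simulation⁻¹ : ∀ {a b b' α α'} → a ∼ b → b ─[ α' ]→ b' → α ∼L α' →
  Σ (Tm 0) λ a' → a ═[ α ]⇒ a' × a' ∼ b'
∼-simulation⁻¹ (lam r) (lam-v vv) (val {vv = vv₁} q) = _ , (_ , ε , lam-v vv₁) , ∼-[] r q
∼-simulation⁻¹ (shift r) (shift-E F') (ctx {F = F} c) =
  _ , (_ , ε , shift-E F) , reset (∼-[] r (lam (reset (∼-plug c (var zero)))))
∼-simulation⁻¹ (reset r) (reset-v vv) τ with ∼-reaches-Value r vv
... | _ , p , va , q = _ , gmap _ reset-τ p ◅◅ (reset-v va ◅ ε) , q
∼-simulation⁻¹ (reset r) (reset-τ d) τ with ∼-simulation⁻¹ r d τ
... | _ , p , q = _ , gmap _ reset-τ p , reset q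
∼-simulation⁻¹ (reset r) (reset-□ d) τ with ∼-simulation⁻¹ r d (ctx hole)
... | _ , (_ , p , d') , q = _ , gmap _ reset-τ p ◅◅ (reset-□ d' ◅ ε) , q
∼-simulation⁻¹ (app r₁ r₂) (β vv) τ with ∼-reaches-Value r₁ (lam _) | ∼-reaches-Value r₂ vv
... | _ , p₁ , lam _ , lam r | _ , p₂ , vv₂ , q₂ =
  _ , gmap _ appL-τ p₁ ◅◅ gmap _ (appR-τ (lam _)) p₂ ◅◅ (β vv₂ ◅ ε) , ∼-[] r q₂
∼-simulation⁻¹ (app r₁ r₂) (appL-τ d) τ with ∼-simulation⁻¹ r₁ d τ
... | _ , p , q = _ , gmap _ appL-τ p , app q r₂
∼-simulation⁻¹ (app r₁ r₂) (appR-τ vv d) τ with ∼-reaches-Value r₁ vv | ∼-simulation⁻¹ r₂ d τ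
... | _ , p₁ , vv₁ , q₁ | _ , p , q = _ , gmap _ appL-τ p₁ ◅◅ gmap _ (appR-τ vv₁) p , app q₁ q
∼-simulation⁻¹ (app r₁ r₂) (appL-E d) (ctx c)
  with ∼-simulation⁻¹ r₁ d (ctx (∼c-∘c c (appL hole r₂)))
... | _ , (_ , p , d') , q = _ , (_ , gmap _ appL-τ p , appL-E d') , q
∼-simulation⁻¹ (app r₁ r₂) (appR-E vv d) (ctx c) with ∼-reaches-Value r₁ vv
... | _ , p₁ , vv₁ , q₁ with ∼-simulation⁻¹ r₂ d (ctx (∼c-∘c c (appR {vv = vv₁} q₁ hole)))
... | _ , (_ , p , d') , q =
  _ , (_ , gmap _ appL-τ p₁ ◅◅ gmap _ (appR-τ vv₁) p , appR-E vv₁ d') , q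
∼-simulation⁻¹ (base E r) d rα with plug-step⁻¹ E d
∼-simulation⁻¹ (base E r) d τ | inner-τ ds with ∼-simulation⁻¹ r ds τ
... | _ , p , q = _ , gmap _ (appR-τ (lam _)) p , base E q
∼-simulation⁻¹ (base E r) d (ctx c) | inner-ctx ds
  with ∼-simulation⁻¹ r ds (ctx (∼c-∘c c (∼c-base-hole E (lam _))))
... | _ , (_ , p , d') , q = _ , (_ , gmap _ (appR-τ (lam _)) p , appR-E (lam _) d') , q
∼-simulation⁻¹ (base E r) d rα | value vs = base-Value-simulation⁻¹ E r vs d rα

proposition4p23 : (E : Ctx) (t : Tm 0) →
    app (lam (plug E (var zero))) t ≈ plug E t
proposition4p23 E t =
  _∼_ , (simulation , simulation⁻¹) , base E (∼-refl t)
  where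
  simulation : IsSimulation _∼_
  simulation r d = ∼-simulation r d (∼L-refl _)

  simulation⁻¹ : IsSimulation (λ a b → b ∼ a)
  simulation⁻¹ r d = ∼-simulation⁻¹ r d (∼L-refl _)
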